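{- For all finite types $\sigma,\tau$, let $\phi:=(\sigma\to0)\to(\tau\to0)$ and $\rho:=\phi\to(\sigma\to0)\to(\sigma\to0)\to\tau\to\sigma$. Then $\mathsf{HA}^\omega$ proves $$\exists Z:\rho^+\;\forall f:\phi^+\Big(\mathrm{dom}_\phi(f)\to\forall x:(\sigma\to0)^+\big(\mathrm{dom}_{\sigma\to0}(x)\to\forall y:(\sigma\to0)^+\big(\mathrm{dom}_{\sigma\to0}(y)\to\forall v:\tau^+\big(\mathrm{dom}_\tau(v)\to(\neg(f*x*v\equiv_0f*y*v)\to\mathrm{dom}_\sigma(Z*f*x*y*v)\wedge\neg(x*(Z*f*x*y*v)\equiv_0y*(Z*f*x*y*v)))\big)\big)\big)\Big).$$
   Context: Finite types are generated by: $0$ is a type; if $\sigma,\tau$ are types, so are $\sigma\times\tau$ and $\sigma\to\tau$ ($\to$ associates to the right). $\mathsf{HA}^\omega$ is the many-sorted intuitionistic first-order theory whose sorts are the finite types. Its terms are built from variables of each type and, for all types $\rho,\sigma,\tau$, the constants $\mathsf{k}:\rho\to\sigma\to\rho$, $\mathsf{s}:(\rho\to\sigma\to\tau)\to(\rho\to\sigma)\to(\rho\to\tau)$, $\mathsf{pair}:\sigma\to\tau\to\sigma\times\tau$, $\mathsf{fst}:\sigma\times\tau\to\sigma$, $\mathsf{snd}:\sigma\times\tau\to\tau$, $0:0$, $S:0\to0$, $\mathsf{R}:\sigma\to(0\to\sigma\to\sigma)\to0\to\sigma$, by application (associating to the left). Atomic formulas are $\bot$ and $s\equiv_\sigma t$;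 $\neg\varphi$ abbreviates $\varphi\to\bot$. Axioms: $\equiv_\sigma$ is an equivalence relation; $x\equiv x'\to y\equiv y'\to xy\equiv x'y'$; $\mathsf{k}xy\equiv x$; $\mathsf{s}xyz\equiv xz(yz)$; $\mathsf{fst}(\mathsf{pair}\,xy)\equiv x$; $\mathsf{snd}(\mathsf{pair}\,xy)\equiv y$; $\mathsf{R}xy0\equiv x$; $\mathsf{R}xy(Sm)\equiv ym(\mathsf{R}xym)$; $Sx\equiv_0Sy\to x\equiv_0y$; $\neg(Sx\equiv_00)$; induction for all formulas. Surjective pairing is not assumed. Auxiliary types and $\mathsf{HA}^\omega$-formulas (by induction on $\sigma$): $0^+:=0$, $0^-:=0$, $\mathrm{dom}_0(x):=\top$, $\mathrm{app}_0(x,y,z):=\neg(x\equiv_0y)$. $(\sigma\times\tau)^+:=\sigma^+\times\tau^+$, $(\sigma\times\tau)^-:=(\sigma^-\times\tau^-)\times0$, $\mathrm{dom}_{\sigma\times\tau}(x):=\mathrm{dom}_\sigma(\mathsf{fst}\,x)\wedge\mathrm{dom}_\tau(\mathsf{snd}\,x)$, $\mathrm{app}_{\sigma\times\tau}(x,y,z):=(\mathsf{snd}\,z\equiv_00\to\mathrm{app}_\sigma(\mathsf{fst}\,x,\mathsf{fst}\,y,\mathsf{fst}(\mathsf{fst}\,z)))\wedge(\neg(\mathsf{snd}\,z\equiv_00)\to\mathrm{app}_\tau(\mathsf{snd}\,x,\mathsf{snd}\,y,\mathsf{snd}(\mathsf{fst}\,z)))$. $(\sigma\to\tau)^+:=(\sigma^+\to\tau^+)\times(\sigma^+\to\sigma^+\to\tau^-\to\sigma^-)$,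 $(\sigma\to\tau)^-:=\sigma^+\times\tau^-$; for $s:(\sigma\to\tau)^+$, $t:\sigma^+$ write $s*t:=(\mathsf{fst}\,s)t:\tau^+$ ($*$ associates to the left); $\mathrm{dom}_{\sigma\to\tau}(x):=\forall u:\sigma^+(\mathrm{dom}_\sigma(u)\to\mathrm{dom}_\tau(x*u))\wedge\forall u,v:\sigma^+\forall w:\tau^-(\mathrm{dom}_\sigma(u)\to\mathrm{dom}_\sigma(v)\to\mathrm{app}_\tau(x*u,x*v,w)\to\mathrm{app}_\sigma(u,v,(\mathsf{snd}\,x)uvw))$; $\mathrm{app}_{\sigma\to\tau}(x,y,z):=\mathrm{dom}_\sigma(\mathsf{fst}\,z)\wedge\mathrm{app}_\tau(x*(\mathsf{fst}\,z),y*(\mathsf{fst}\,z),\mathsf{snd}\,z)$. -}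

module Defs where

open import Data.List using (List; []; _∷_; map)
open import Data.List.Membership.Propositional using (_∈_)

infixr 30 _⇒_
infixr 35 _⊗_

data Ty : Set where
  𝟘   : Ty
  _⊗_ : Ty → Ty → Ty
  _⇒_ : Ty → Ty → Ty

Ctx : Set
Ctx = List Ty

data Var : Ctx → Ty → Set where
  vz : ∀ {Γ σ} → Var (σ ∷ Γ) σ
  vs : ∀ {Γ σ τ} → Var Γ σ → Var (τ ∷ Γ) σ

infixl 50 _·_

data Tm (Γ : Ctx) : Ty → Set where
  var  : ∀ {σ} → Var Γ σ → Tm Γ σ
  K    : ∀ {ρ σ} → Tm Γ (ρ ⇒ σ ⇒ ρ)
  S    : ∀ {ρ σ τ} → Tm Γ ((ρ ⇒ σ ⇒ τ) ⇒ (ρ ⇒ σ) ⇒ (ρ ⇒ τ))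
  pair : ∀ {σ τ} → Tm Γ (σ ⇒ τ ⇒ σ ⊗ τ)
  fst  : ∀ {σ τ} → Tm Γ (σ ⊗ τ ⇒ σ)
  snd  : ∀ {σ τ} → Tm Γ (σ ⊗ τ ⇒ τ)
  zero : Tm Γ 𝟘
  suc  : Tm Γ (𝟘 ⇒ 𝟘)
  R    : ∀ {σ} → Tm Γ (σ ⇒ (𝟘 ⇒ σ ⇒ σ) ⇒ 𝟘 ⇒ σ)
  _·_  : ∀ {σ τ} → Tm Γ (σ ⇒ τ) → Tm Γ σ → Tm Γ τ

infixr 20 _⊃_
infixr 25 _∧_ _∨_
infix  40 _≐_

data Fm (Γ : Ctx) : Set where
  ⊥'   : Fm Γ
  _≐_  : ∀ {σ} → Tm Γ σ → Tm Γ σ → Fm Γ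
  _⊃_  : Fm Γ → Fm Γ → Fm Γ
  _∧_  : Fm Γ → Fm Γ → Fm Γ
  _∨_  : Fm Γ → Fm Γ → Fm Γ
  ∀'   : (σ : Ty) → Fm (σ ∷ Γ) → Fm Γ
  ∃'   : (σ : Ty) → Fm (σ ∷ Γ) → Fm Γ

¬' : ∀ {Γ} → Fm Γ → Fm Γ
¬' φ = φ ⊃ ⊥'

⊤' : ∀ {Γ} → Fm Γ
⊤' = ⊥' ⊃ ⊥'

Ren : Ctx → Ctx → Set
Ren Γ Δ = ∀ {σ} → Var Γ σ → Var Δ σ

liftR : ∀ {Γ Δ τ} → Ren Γ Δ → Ren (τ ∷ Γ) (τ ∷ Δ)
liftR r vz     = vz
liftR r (vs x) = vs (r x)

renT : ∀ {Γ Δ σ} → Ren Γ Δ → Tm Γ σ → Tm Δ σ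
renT r (var x) = var (r x)
renT r K       = K
renT r S       = S
renT r pair    = pair
renT r fst     = fst
renT r snd     = snd
renT r zero    = zero
renT r suc     = suc
renT r R       = R
renT r (t · u) = renT r t · renT r u

renF : ∀ {Γ Δ} → Ren Γ Δ → Fm Γ → Fm Δ
renF r ⊥'       = ⊥'
renF r (t ≐ u)  = renT r t ≐ renT r u
renF r (φ ⊃ ψ)  = renF r φ ⊃ renF r ψ
renF r (φ ∧ ψ)  = renF r φ ∧ renF r ψ
renF r (φ ∨ ψ)  = renF r φ ∨ renF r ψ
renF r (∀' σ φ) = ∀' σ (renF (liftR r) φ)
renF r (∃' σ φ) = ∃' σ (renF (liftR r) φ)

wkT : ∀ {Γ σ τ} → Tm Γ σ → Tm (τ ∷ Γ) σ
wkT = renT vs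

wkF : ∀ {Γ τ} → Fm Γ → Fm (τ ∷ Γ)
wkF = renF vs

Sub : Ctx → Ctx → Set
Sub Γ Δ = ∀ {σ} → Var Γ σ → Tm Δ σ

liftS : ∀ {Γ Δ τ} → Sub Γ Δ → Sub (τ ∷ Γ) (τ ∷ Δ)
liftS s vz     = var vz
liftS s (vs x) = wkT (s x)

subT : ∀ {Γ Δ σ} → Sub Γ Δ → Tm Γ σ → Tm Δ σ
subT s (var x) = s x
subT s K       = K
subT s S       = S
subT s pair    = pair
subT s fst     = fst
subT s snd     = snd
subT s zero    = zero
subT s suc     = suc
subT s R       = R
subT s (t · u) = subT s t · subT s u

subF : ∀ {Γ Δ} → Sub Γ Δ → Fm Γ → Fm Δ
subF s ⊥'       = ⊥'
subF s (t ≐ u)  = subT s t ≐ subT s u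
subF s (φ ⊃ ψ)  = subF s φ ⊃ subF s ψ
subF s (φ ∧ ψ)  = subF s φ ∧ subF s ψ
subF s (φ ∨ ψ)  = subF s φ ∨ subF s ψ
subF s (∀' σ φ) = ∀' σ (subF (liftS s) φ)
subF s (∃' σ φ) = ∃' σ (subF (liftS s) φ)

single : ∀ {Γ σ} → Tm Γ σ → Sub (σ ∷ Γ) Γ
single t vz     = t
single t (vs x) = var x

infixl 60 _[_]
_[_] : ∀ {Γ σ} → Fm (σ ∷ Γ) → Tm Γ σ → Fm Γ
φ [ t ] = subF (single t) φ

sucSub : ∀ {Γ} → Sub (𝟘 ∷ Γ) (𝟘 ∷ Γ)
sucSub vz     = suc · var vz
sucSub (vs x) = var (vs x)

data HA⊢ (Γ : Ctx) (Δ : List (Fm Γ)) : Fm Γ → Set where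
  hyp   : ∀ {φ} → φ ∈ Δ → HA⊢ Γ Δ φ
  ⊥E    : ∀ {φ} → HA⊢ Γ Δ ⊥' → HA⊢ Γ Δ φ
  ⊃I    : ∀ {φ ψ} → HA⊢ Γ (φ ∷ Δ) ψ → HA⊢ Γ Δ (φ ⊃ ψ)
  ⊃E    : ∀ {φ ψ} → HA⊢ Γ Δ (φ ⊃ ψ) → HA⊢ Γ Δ φ → HA⊢ Γ Δ ψ
  ∧I    : ∀ {φ ψ} → HA⊢ Γ Δ φ → HA⊢ Γ Δ ψ → HA⊢ Γ Δ (φ ∧ ψ)
  ∧E₁   : ∀ {φ ψ} → HA⊢ Γ Δ (φ ∧ ψ) → HA⊢ Γ Δ φ
  ∧E₂   : ∀ {φ ψ} → HA⊢ Γ Δ (φ ∧ ψ) → HA⊢ Γ Δ ψ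
  ∨I₁   : ∀ {φ ψ} → HA⊢ Γ Δ φ → HA⊢ Γ Δ (φ ∨ ψ)
  ∨I₂   : ∀ {φ ψ} → HA⊢ Γ Δ ψ → HA⊢ Γ Δ (φ ∨ ψ)
  ∨E    : ∀ {φ ψ χ} → HA⊢ Γ Δ (φ ∨ ψ) → HA⊢ Γ (φ ∷ Δ) χ → HA⊢ Γ (ψ ∷ Δ) χ
          → HA⊢ Γ Δ χ
  ∀I    : ∀ {σ φ} → HA⊢ (σ ∷ Γ) (map wkF Δ) φ → HA⊢ Γ Δ (∀' σ φ)
  ∀E    : ∀ {σ φ} → HA⊢ Γ Δ (∀' σ φ) → (t : Tm Γ σ) → HA⊢ Γ Δ (φ [ t ])
  ∃I    : ∀ {σ φ} (t : Tm Γ σ) → HA⊢ Γ Δ (φ [ t ]) → HA⊢ Γ Δ (∃' σ φ)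
  ∃E    : ∀ {σ φ ψ} → HA⊢ Γ Δ (∃' σ φ) → HA⊢ (σ ∷ Γ) (φ ∷ map wkF Δ) (wkF ψ)
          → HA⊢ Γ Δ ψ
  eq-refl  : ∀ {σ} (t : Tm Γ σ) → HA⊢ Γ Δ (t ≐ t)
  eq-sym   : ∀ {σ} (t u : Tm Γ σ) → HA⊢ Γ Δ (t ≐ u ⊃ u ≐ t)
  eq-trans : ∀ {σ} (t u v : Tm Γ σ) → HA⊢ Γ Δ (t ≐ u ⊃ u ≐ v ⊃ t ≐ v)
  eq-app   : ∀ {σ τ} (x x' : Tm Γ (σ ⇒ τ)) (y y' : Tm Γ σ)
             → HA⊢ Γ Δ (x ≐ x' ⊃ y ≐ y' ⊃ x · y ≐ x' · y')
  ax-K     : ∀ {ρ σ} (x : Tm Γ ρ) (y : Tm Γ σ) → HA⊢ Γ Δ (K · x · y ≐ x)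
  ax-S     : ∀ {ρ σ τ} (x : Tm Γ (ρ ⇒ σ ⇒ τ)) (y : Tm Γ (ρ ⇒ σ)) (z : Tm Γ ρ)
             → HA⊢ Γ Δ (S · x · y · z ≐ x · z · (y · z))
  ax-fst   : ∀ {σ τ} (x : Tm Γ σ) (y : Tm Γ τ) → HA⊢ Γ Δ (fst · (pair · x · y) ≐ x)
  ax-snd   : ∀ {σ τ} (x : Tm Γ σ) (y : Tm Γ τ) → HA⊢ Γ Δ (snd · (pair · x · y) ≐ y)
  ax-R0    : ∀ {σ} (x : Tm Γ σ) (y : Tm Γ (𝟘 ⇒ σ ⇒ σ)) → HA⊢ Γ Δ (R · x · y · zero ≐ x)
  ax-RS    : ∀ {σ} (x : Tm Γ σ) (y : Tm Γ (𝟘 ⇒ σ ⇒ σ)) (m : Tm Γ 𝟘)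
             → HA⊢ Γ Δ (R · x · y · (suc · m) ≐ y · m · (R · x · y · m))
  ax-Sinj  : (x y : Tm Γ 𝟘) → HA⊢ Γ Δ (suc · x ≐ suc · y ⊃ x ≐ y)
  ax-S≠0   : (x : Tm Γ 𝟘) → HA⊢ Γ Δ (¬' (suc · x ≐ zero))
  ax-ind   : (φ : Fm (𝟘 ∷ Γ))
             → HA⊢ Γ Δ (φ [ zero ] ⊃ ∀' 𝟘 (φ ⊃ subF sucSub φ) ⊃ ∀' 𝟘 φ)

HAω⊢ : Fm [] → Set
HAω⊢ φ = HA⊢ [] [] φ

infix 60 _⁺ _⁻

_⁺ : Ty → Ty
_⁻ : Ty → Ty
𝟘 ⁺       = 𝟘
(σ ⊗ τ) ⁺ = σ ⁺ ⊗ τ ⁺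
(σ ⇒ τ) ⁺ = (σ ⁺ ⇒ τ ⁺) ⊗ (σ ⁺ ⇒ σ ⁺ ⇒ τ ⁻ ⇒ σ ⁻)
𝟘 ⁻       = 𝟘
(σ ⊗ τ) ⁻ = (σ ⁻ ⊗ τ ⁻) ⊗ 𝟘
(σ ⇒ τ) ⁻ = σ ⁺ ⊗ τ ⁻

-- s * t := (fst s) t ; the types σ, τ are given explicitly since
-- _⁺ is not injective (so they could not be inferred)
ap : ∀ {Γ} (σ τ : Ty) → Tm Γ ((σ ⇒ τ) ⁺) → Tm Γ (σ ⁺) → Tm Γ (τ ⁺)
ap σ τ s t = fst · s · t

v0 : ∀ {Γ σ} → Tm (σ ∷ Γ) σ
v0 = var vz
v1 : ∀ {Γ σ τ} → Tm (τ ∷ σ ∷ Γ) σ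
v1 = var (vs vz)
v2 : ∀ {Γ σ τ ρ} → Tm (ρ ∷ τ ∷ σ ∷ Γ) σ
v2 = var (vs (vs vz))

wk3T : ∀ {Γ σ a b c} → Tm Γ σ → Tm (a ∷ b ∷ c ∷ Γ) σ
wk3T t = wkT (wkT (wkT t))

dom : ∀ {Γ} (σ : Ty) → Tm Γ (σ ⁺) → Fm Γ
app : ∀ {Γ} (σ : Ty) → Tm Γ (σ ⁺) → Tm Γ (σ ⁺) → Tm Γ (σ ⁻) → Fm Γ

dom 𝟘       x = ⊤'
dom (σ ⊗ τ) x = dom σ (fst · x) ∧ dom τ (snd · x)
dom (σ ⇒ τ) x =
  ∀' (σ ⁺) (dom σ v0 ⊃ dom τ (ap σ τ (wkT x) v0)) ∧
  ∀' (σ ⁺) (∀' (σ ⁺) (∀' (τ ⁻)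
    (dom σ v2 ⊃ dom σ v1 ⊃ app τ (ap σ τ (wk3T x) v2) (ap σ τ (wk3T x) v1) v0
      ⊃ app σ v2 v1 (snd · wk3T x · v2 · v1 · v0))))

app 𝟘       x y z = ¬' (x ≐ y)
app (σ ⊗ τ) x y z =
  (snd · z ≐ zero ⊃ app σ (fst · x) (fst · y) (fst · (fst · z))) ∧
  (¬' (snd · z ≐ zero) ⊃ app τ (snd · x) (snd · y) (snd · (fst · z)))
app (σ ⇒ τ) x y z = dom σ (fst · z) ∧ app τ (ap σ τ x (fst · z)) (ap σ τ y (fst · z)) (snd · z)

φTy : Ty → Ty → Ty
φTy σ τ = (σ ⇒ 𝟘) ⇒ (τ ⇒ 𝟘)

ρTy : Ty → Ty → Ty
ρTy σ τ = φTy σ τ ⇒ (σ ⇒ 𝟘) ⇒ (σ ⇒ 𝟘) ⇒ τ ⇒ σ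

-- Bound variables, innermost first:  v, y, x, f, Z
Thm5p6Formula : (σ τ : Ty) → Fm []
Thm5p6Formula σ τ =
  ∃' (ρTy σ τ ⁺)
   (∀' (φTy σ τ ⁺)
    (dom (φTy σ τ) f₁ ⊃
     ∀' ((σ ⇒ 𝟘) ⁺)
      (dom (σ ⇒ 𝟘) x₂ ⊃
       ∀' ((σ ⇒ 𝟘) ⁺)
        (dom (σ ⇒ 𝟘) y₃ ⊃
         ∀' (τ ⁺)
          (dom τ v₄ ⊃
           (¬' (fxv ≐ fyv) ⊃
            (dom σ W ∧ ¬' (ap σ 𝟘 x₄ W ≐ ap σ 𝟘 y₄ W))))))))
  where
  Γ₄ : Ctx
  Γ₄ = τ ⁺ ∷ (σ ⇒ 𝟘) ⁺ ∷ (σ ⇒ 𝟘) ⁺ ∷ φTy σ τ ⁺ ∷ ρTy σ τ ⁺ ∷ []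
  f₁ : Tm (φTy σ τ ⁺ ∷ ρTy σ τ ⁺ ∷ []) (φTy σ τ ⁺)
  f₁ = var vz
  x₂ : Tm ((σ ⇒ 𝟘) ⁺ ∷ φTy σ τ ⁺ ∷ ρTy σ τ ⁺ ∷ []) ((σ ⇒ 𝟘) ⁺)
  x₂ = var vz
  y₃ : Tm ((σ ⇒ 𝟘) ⁺ ∷ (σ ⇒ 𝟘) ⁺ ∷ φTy σ τ ⁺ ∷ ρTy σ τ ⁺ ∷ []) ((σ ⇒ 𝟘) ⁺)
  y₃ = var vz
  v₄ : Tm Γ₄ (τ ⁺)
  v₄ = var vz
  y₄ : Tm Γ₄ ((σ ⇒ 𝟘) ⁺)
  y₄ = var (vs vz)
  x₄ : Tm Γ₄ ((σ ⇒ 𝟘) ⁺)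
  x₄ = var (vs (vs vz))
  f₄ : Tm Γ₄ (φTy σ τ ⁺)
  f₄ = var (vs (vs (vs vz)))
  Z₄ : Tm Γ₄ (ρTy σ τ ⁺)
  Z₄ = var (vs (vs (vs (vs vz))))
  W : Tm Γ₄ (σ ⁺)
  -- W = Z * f * x * y * v
  W = ap τ σ (ap (σ ⇒ 𝟘) (τ ⇒ σ) (ap (σ ⇒ 𝟘) ((σ ⇒ 𝟘) ⇒ τ ⇒ σ)
        (ap (φTy σ τ) ((σ ⇒ 𝟘) ⇒ (σ ⇒ 𝟘) ⇒ τ ⇒ σ) Z₄ f₄) x₄) y₄) v₄
  -- f * x * v  and  f * y * v
  fxv fyv : Tm Γ₄ 𝟘
  fxv = ap τ 𝟘 (ap (σ ⇒ 𝟘) (τ ⇒ 𝟘) f₄ x₄) v₄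
  fyv = ap τ 𝟘 (ap (σ ⇒ 𝟘) (τ ⇒ 𝟘) f₄ y₄) v₄

-- A realiser f of φ comes with a backward component snd f which, given points
-- u, u' of σ → 0 and a counterexample w to f * u and f * u' agreeing, returns a
-- counterexample to u and u' agreeing.  Feeding it the point v, packaged as the
-- counterexample ⟨v, 0⟩ to f * x and f * y agreeing, yields a point of σ on
-- which x and y differ; so Z := λf x y v. fst (snd f x y ⟨v, 0⟩), written as a
-- closed term by bracket abstraction, is the required witness.
module Submission where

open import Defs
open import Data.List using (List; []; _∷_; map)
open import Data.List.Relation.Unary.Any using (here; there)
open import Relation.Binary.PropositionalEquality
  using (_≡_; refl; sym; trans; cong; cong₂; module ≡-Reasoning)

cong₃ : ∀ {A B C D : Set} (f : A → B → C → D) {a a' b b' c c'}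
  → a ≡ a' → b ≡ b' → c ≡ c' → f a b c ≡ f a' b' c'
cong₃ f refl refl refl = refl

subT-cong : ∀ {Γ Δ σ} {s s' : Sub Γ Δ} → (∀ {ρ} (x : Var Γ ρ) → s x ≡ s' x)
  → (t : Tm Γ σ) → subT s t ≡ subT s' t
subT-cong e (var x) = e x
subT-cong e K       = refl
subT-cong e S       = refl
subT-cong e pair    = refl
subT-cong e fst     = refl
subT-cong e snd     = refl
subT-cong e zero    = refl
subT-cong e suc     = refl
subT-cong e R       = refl
subT-cong e (t · u) = cong₂ _·_ (subT-cong e t) (subT-cong e u)

subT-var : ∀ {Γ σ} (t : Tm Γ σ) → subT var t ≡ t
subT-var (var x) = refl
subT-var K       = refl
subT-var S       = refl
subT-var pair    = refl
subT-var fst     = refl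
subT-var snd     = refl
subT-var zero    = refl
subT-var suc     = refl
subT-var R       = refl
subT-var (t · u) = cong₂ _·_ (subT-var t) (subT-var u)

renT-renT : ∀ {Γ Δ Θ σ} (r : Ren Δ Θ) (r' : Ren Γ Δ) (t : Tm Γ σ)
  → renT r (renT r' t) ≡ renT (λ x → r (r' x)) t
renT-renT r r' (var x) = refl
renT-renT r r' K       = refl
renT-renT r r' S       = refl
renT-renT r r' pair    = refl
renT-renT r r' fst     = refl
renT-renT r r' snd     = refl
renT-renT r r' zero    = refl
renT-renT r r' suc     = refl
renT-renT r r' R       = refl
renT-renT r r' (t · u) = cong₂ _·_ (renT-renT r r' t) (renT-renT r r' u)

subT-renT : ∀ {Γ Δ Θ σ} (s : Sub Δ Θ) (r : Ren Γ Δ) (t : Tm Γ σ)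
  → subT s (renT r t) ≡ subT (λ x → s (r x)) t
subT-renT s r (var x) = refl
subT-renT s r K       = refl
subT-renT s r S       = refl
subT-renT s r pair    = refl
subT-renT s r fst     = refl
subT-renT s r snd     = refl
subT-renT s r zero    = refl
subT-renT s r suc     = refl
subT-renT s r R       = refl
subT-renT s r (t · u) = cong₂ _·_ (subT-renT s r t) (subT-renT s r u)

renT-subT : ∀ {Γ Δ Θ σ} (r : Ren Δ Θ) (s : Sub Γ Δ) (t : Tm Γ σ)
  → renT r (subT s t) ≡ subT (λ x → renT r (s x)) t
renT-subT r s (var x) = refl
renT-subT r s K       = refl
renT-subT r s S       = refl
renT-subT r s pair    = refl
renT-subT r s fst     = refl
renT-subT r s snd     = refl
renT-subT r s zero    = refl
renT-subT r s suc     = refl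
renT-subT r s R       = refl
renT-subT r s (t · u) = cong₂ _·_ (renT-subT r s t) (renT-subT r s u)

liftR-wkT : ∀ {Γ Δ σ ρ} (r : Ren Γ Δ) (t : Tm Γ σ)
  → renT (liftR {τ = ρ} r) (wkT t) ≡ wkT (renT r t)
liftR-wkT r t = trans (renT-renT (liftR r) vs t) (sym (renT-renT vs r t))

liftS-wkT : ∀ {Γ Δ σ ρ} (s : Sub Γ Δ) (t : Tm Γ σ)
  → subT (liftS {τ = ρ} s) (wkT t) ≡ wkT (subT s t)
liftS-wkT s t = trans (subT-renT (liftS s) vs t) (sym (renT-subT vs s t))

single-wkT : ∀ {Γ σ ρ} (u : Tm Γ ρ) (t : Tm Γ σ) → subT (single u) (wkT t) ≡ t
single-wkT u t = trans (subT-renT (single u) vs t) (subT-var t)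

liftR³-wk3T : ∀ {Γ Δ σ a b c} (r : Ren Γ Δ) (t : Tm Γ σ)
  → renT (liftR {τ = a} (liftR {τ = b} (liftR {τ = c} r))) (wk3T t) ≡ wk3T (renT r t)
liftR³-wk3T r t =
  trans (liftR-wkT (liftR (liftR r)) (wkT (wkT t)))
        (cong wkT (trans (liftR-wkT (liftR r) (wkT t)) (cong wkT (liftR-wkT r t))))

liftS³-wk3T : ∀ {Γ Δ σ a b c} (s : Sub Γ Δ) (t : Tm Γ σ)
  → subT (liftS {τ = a} (liftS {τ = b} (liftS {τ = c} s))) (wk3T t) ≡ wk3T (subT s t)
liftS³-wk3T s t =
  trans (liftS-wkT (liftS (liftS s)) (wkT (wkT t)))
        (cong wkT (trans (liftS-wkT (liftS s) (wkT t)) (cong wkT (liftS-wkT s t))))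

none : ∀ {Γ} → Sub [] Γ
none ()

embed : ∀ {Γ ρ} → Tm [] ρ → Tm Γ ρ
embed = subT none

embed-[] : ∀ {ρ} (t : Tm [] ρ) → embed t ≡ t
embed-[] t = trans (subT-cong (λ ()) t) (subT-var t)

wkT-embed : ∀ {Γ ρ τ} (t : Tm [] ρ) → wkT {Γ} {τ = τ} (embed t) ≡ embed t
wkT-embed t = trans (renT-subT vs none t) (subT-cong (λ ()) t)

wkT⁴-closed : ∀ {ρ a b c d} (t : Tm [] ρ)
  → wkT {τ = a} (wkT {τ = b} (wkT {τ = c} (wkT {τ = d} t))) ≡ embed t
wkT⁴-closed t = begin
  wkT (wkT (wkT (wkT t)))          ≡⟨ cong (λ u → wkT (wkT (wkT (wkT u)))) (sym (embed-[] t)) ⟩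
  wkT (wkT (wkT (wkT (embed t))))  ≡⟨ cong (λ u → wkT (wkT (wkT u))) (wkT-embed t) ⟩
  wkT (wkT (wkT (embed t)))        ≡⟨ cong (λ u → wkT (wkT u)) (wkT-embed t) ⟩
  wkT (wkT (embed t))              ≡⟨ cong wkT (wkT-embed t) ⟩
  wkT (embed t)                    ≡⟨ wkT-embed t ⟩
  embed t                          ∎
  where open ≡-Reasoning

renF-dom : ∀ {Γ Δ} (r : Ren Γ Δ) σ (t : Tm Γ (σ ⁺)) → renF r (dom σ t) ≡ dom σ (renT r t)
renF-app : ∀ {Γ Δ} (r : Ren Γ Δ) σ (x y : Tm Γ (σ ⁺)) (z : Tm Γ (σ ⁻))
  → renF r (app σ x y z) ≡ app σ (renT r x) (renT r y) (renT r z)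
renF-dom r 𝟘       t = refl
renF-dom r (σ ⊗ τ) t = cong₂ _∧_ (renF-dom r σ _) (renF-dom r τ _)
renF-dom r (σ ⇒ τ) x =
  cong₂ _∧_
    (cong (∀' (σ ⁺)) (cong₂ _⊃_ (renF-dom (liftR r) σ v0)
       (trans (renF-dom (liftR r) τ _) (cong (λ u → dom τ (fst · u · v0)) (liftR-wkT r x)))))
    (cong (∀' (σ ⁺)) (cong (∀' (σ ⁺)) (cong (∀' (τ ⁻))
      (cong₂ _⊃_ (renF-dom r³ σ v2) (cong₂ _⊃_ (renF-dom r³ σ v1) (cong₂ _⊃_
        (trans (renF-app r³ τ _ _ _)
               (cong (λ u → app τ (fst · u · v2) (fst · u · v1) v0) (liftR³-wk3T r x)))
        (trans (renF-app r³ σ _ _ _)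
               (cong (λ u → app σ v2 v1 (snd · u · v2 · v1 · v0)) (liftR³-wk3T r x)))))))))
  where r³ = liftR (liftR (liftR r))
renF-app r 𝟘       x y z = refl
renF-app r (σ ⊗ τ) x y z =
  cong₂ _∧_ (cong (_ ⊃_) (renF-app r σ _ _ _)) (cong (_ ⊃_) (renF-app r τ _ _ _))
renF-app r (σ ⇒ τ) x y z = cong₂ _∧_ (renF-dom r σ _) (renF-app r τ _ _ _)

subF-dom : ∀ {Γ Δ} (s : Sub Γ Δ) σ (t : Tm Γ (σ ⁺)) → subF s (dom σ t) ≡ dom σ (subT s t)
subF-app : ∀ {Γ Δ} (s : Sub Γ Δ) σ (x y : Tm Γ (σ ⁺)) (z : Tm Γ (σ ⁻))
  → subF s (app σ x y z) ≡ app σ (subT s x) (subT s y) (subT s z)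
subF-dom s 𝟘       t = refl
subF-dom s (σ ⊗ τ) t = cong₂ _∧_ (subF-dom s σ _) (subF-dom s τ _)
subF-dom s (σ ⇒ τ) x =
  cong₂ _∧_
    (cong (∀' (σ ⁺)) (cong₂ _⊃_ (subF-dom (liftS s) σ v0)
       (trans (subF-dom (liftS s) τ _) (cong (λ u → dom τ (fst · u · v0)) (liftS-wkT s x)))))
    (cong (∀' (σ ⁺)) (cong (∀' (σ ⁺)) (cong (∀' (τ ⁻))
      (cong₂ _⊃_ (subF-dom s³ σ v2) (cong₂ _⊃_ (subF-dom s³ σ v1) (cong₂ _⊃_
        (trans (subF-app s³ τ _ _ _)
               (cong (λ u → app τ (fst · u · v2) (fst · u · v1) v0) (liftS³-wk3T s x)))
        (trans (subF-app s³ σ _ _ _)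
               (cong (λ u → app σ v2 v1 (snd · u · v2 · v1 · v0)) (liftS³-wk3T s x)))))))))
  where s³ = liftS (liftS (liftS s))
subF-app s 𝟘       x y z = refl
subF-app s (σ ⊗ τ) x y z =
  cong₂ _∧_ (cong (_ ⊃_) (subF-app s σ _ _ _)) (cong (_ ⊃_) (subF-app s τ _ _ _))
subF-app s (σ ⇒ τ) x y z = cong₂ _∧_ (subF-dom s σ _) (subF-app s τ _ _ _)

wkF²-dom : ∀ {Γ a b} σ (t : Tm Γ (σ ⁺))
  → wkF {τ = a} (wkF {τ = b} (dom σ t)) ≡ dom σ (wkT (wkT t))
wkF²-dom σ t = trans (cong wkF (renF-dom vs σ t)) (renF-dom vs σ (wkT t))

wkF³-dom : ∀ {Γ a b c} σ (t : Tm Γ (σ ⁺))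
  → wkF {τ = a} (wkF {τ = b} (wkF {τ = c} (dom σ t))) ≡ dom σ (wk3T t)
wkF³-dom σ t = trans (cong wkF (wkF²-dom σ t)) (renF-dom vs σ (wkT (wkT t)))

v3 : ∀ {Γ σ a b c} → Tm (c ∷ b ∷ a ∷ σ ∷ Γ) σ
v3 = var (vs (vs (vs vz)))

cast : ∀ {Γ Δ φ ψ} → φ ≡ ψ → HA⊢ Γ Δ φ → HA⊢ Γ Δ ψ
cast refl d = d

H0 : ∀ {Γ a Δ} → HA⊢ Γ (a ∷ Δ) a
H0 = hyp (here refl)
H1 : ∀ {Γ a b Δ} → HA⊢ Γ (b ∷ a ∷ Δ) a
H1 = hyp (there (here refl))
H2 : ∀ {Γ a b c Δ} → HA⊢ Γ (c ∷ b ∷ a ∷ Δ) a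
H2 = hyp (there (there (here refl)))
H3 : ∀ {Γ a b c d Δ} → HA⊢ Γ (d ∷ c ∷ b ∷ a ∷ Δ) a
H3 = hyp (there (there (there (here refl))))
H4 : ∀ {Γ a b c d e Δ} → HA⊢ Γ (e ∷ d ∷ c ∷ b ∷ a ∷ Δ) a
H4 = hyp (there (there (there (there (here refl)))))
H5 : ∀ {Γ a b c d e f Δ} → HA⊢ Γ (f ∷ e ∷ d ∷ c ∷ b ∷ a ∷ Δ) a
H5 = hyp (there (there (there (there (there (here refl))))))

≐-sym : ∀ {Γ Δ σ} {a b : Tm Γ σ} → HA⊢ Γ Δ (a ≐ b) → HA⊢ Γ Δ (b ≐ a)
≐-sym p = ⊃E (eq-sym _ _) p

≐-trans : ∀ {Γ Δ σ} {a b c : Tm Γ σ} → HA⊢ Γ Δ (a ≐ b) → HA⊢ Γ Δ (b ≐ c) → HA⊢ Γ Δ (a ≐ c)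
≐-trans p q = ⊃E (⊃E (eq-trans _ _ _) p) q

·-cong : ∀ {Γ Δ σ τ} {f f' : Tm Γ (σ ⇒ τ)} {a a' : Tm Γ σ}
  → HA⊢ Γ Δ (f ≐ f') → HA⊢ Γ Δ (a ≐ a') → HA⊢ Γ Δ (f · a ≐ f' · a')
·-cong p q = ⊃E (⊃E (eq-app _ _ _ _) p) q

·-congˡ : ∀ {Γ Δ σ τ} {f : Tm Γ (σ ⇒ τ)} {a a' : Tm Γ σ}
  → HA⊢ Γ Δ (a ≐ a') → HA⊢ Γ Δ (f · a ≐ f · a')
·-congˡ = ·-cong (eq-refl _)

·-congʳ : ∀ {Γ Δ σ τ} {f f' : Tm Γ (σ ⇒ τ)} {a : Tm Γ σ}
  → HA⊢ Γ Δ (f ≐ f') → HA⊢ Γ Δ (f · a ≐ f' · a)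
·-congʳ p = ·-cong p (eq-refl _)

dom⇒-dom : ∀ {Γ Δ} σ τ {X : Tm Γ ((σ ⇒ τ) ⁺)} {u : Tm Γ (σ ⁺)}
  → HA⊢ Γ Δ (dom (σ ⇒ τ) X) → HA⊢ Γ Δ (dom σ u) → HA⊢ Γ Δ (dom τ (fst · X · u))
dom⇒-dom σ τ {X} {u} d du = ⊃E (cast instance-eq (∀E (∧E₁ d) u)) du
  where
  instance-eq : subF (single u) (dom σ v0 ⊃ dom τ (fst · wkT X · v0))
                ≡ (dom σ u ⊃ dom τ (fst · X · u))
  instance-eq = cong₂ _⊃_ (subF-dom (single u) σ v0)
    (trans (subF-dom (single u) τ _) (cong (λ q → dom τ (fst · q · u)) (single-wkT u X)))

dom⇒-app : ∀ {Γ Δ} σ τ {X : Tm Γ ((σ ⇒ τ) ⁺)} {u u' : Tm Γ (σ ⁺)} {w : Tm Γ (τ ⁻)}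
  → HA⊢ Γ Δ (dom (σ ⇒ τ) X) → HA⊢ Γ Δ (dom σ u) → HA⊢ Γ Δ (dom σ u')
  → HA⊢ Γ Δ (app τ (fst · X · u) (fst · X · u') w)
  → HA⊢ Γ Δ (app σ u u' (snd · X · u · u' · w))
dom⇒-app {Γ} σ τ {X} {u} {u'} {w} d du du' a =
  ⊃E (⊃E (⊃E (cast instance-eq (∀E (∀E (∀E (∧E₂ d) u) u') w)) du) du') a
  where
  s₁ = single w
  s₂ = liftS {τ = τ ⁻} (single u')
  s₃ = liftS {τ = τ ⁻} (liftS {τ = σ ⁺} (single u))
  inst : ∀ {ρ} → Tm (τ ⁻ ∷ σ ⁺ ∷ σ ⁺ ∷ Γ) ρ → Tm Γ ρ
  inst t = subT s₁ (subT s₂ (subT s₃ t))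
  inst-wk² : ∀ {ρ} (t : Tm Γ ρ) → subT s₁ (subT s₂ (wkT (wkT t))) ≡ t
  inst-wk² t = trans (cong (subT s₁) (liftS-wkT (single u') (wkT t)))
                     (trans (single-wkT w _) (single-wkT u' t))
  inst-X : inst (wk3T X) ≡ X
  inst-X = trans (cong (λ q → subT s₁ (subT s₂ q)) s₃-wk3T) (inst-wk² X)
    where
    s₃-wk3T : subT s₃ (wk3T X) ≡ wkT (wkT X)
    s₃-wk3T = trans (liftS-wkT (liftS (single u)) (wkT (wkT X)))
                    (cong wkT (trans (liftS-wkT (single u) (wkT X)) (cong wkT (single-wkT u X))))
  inst-u : inst v2 ≡ u
  inst-u = inst-wk² u
  inst-u' : inst v1 ≡ u'
  inst-u' = single-wkT w u'
  inst-dom : ∀ ρ (t : Tm _ (ρ ⁺)) → subF s₁ (subF s₂ (subF s₃ (dom ρ t))) ≡ dom ρ (inst t)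
  inst-dom ρ t = trans (cong (λ φ → subF s₁ (subF s₂ φ)) (subF-dom s₃ ρ t))
                       (trans (cong (subF s₁) (subF-dom s₂ ρ _)) (subF-dom s₁ ρ _))
  inst-app : ∀ ρ x y z → subF s₁ (subF s₂ (subF s₃ (app ρ x y z))) ≡ app ρ (inst x) (inst y) (inst z)
  inst-app ρ x y z = trans (cong (λ φ → subF s₁ (subF s₂ φ)) (subF-app s₃ ρ x y z))
                           (trans (cong (subF s₁) (subF-app s₂ ρ _ _ _)) (subF-app s₁ ρ _ _ _))
  instance-eq : subF s₁ (subF s₂ (subF s₃
                  (dom σ v2 ⊃ dom σ v1 ⊃ app τ (fst · wk3T X · v2) (fst · wk3T X · v1) v0
                     ⊃ app σ v2 v1 (snd · wk3T X · v2 · v1 · v0))))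
                ≡ (dom σ u ⊃ dom σ u' ⊃ app τ (fst · X · u) (fst · X · u') w
                     ⊃ app σ u u' (snd · X · u · u' · w))
  instance-eq =
    cong₂ _⊃_ (trans (inst-dom σ v2) (cong (dom σ) inst-u))
      (cong₂ _⊃_ (trans (inst-dom σ v1) (cong (dom σ) inst-u'))
        (cong₂ _⊃_
          (trans (inst-app τ _ _ _)
                 (cong₃ (λ p q q' → app τ (fst · p · q) (fst · p · q') w) inst-X inst-u inst-u'))
          (trans (inst-app σ _ _ _)
                 (cong₃ (λ p q q' → app σ q q' (snd · p · q · q' · w)) inst-X inst-u inst-u'))))

dom-≐ : ∀ {Γ Δ} σ (a b : Tm Γ (σ ⁺)) → HA⊢ Γ Δ (a ≐ b ⊃ dom σ a ⊃ dom σ b)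
app-≐ : ∀ {Γ Δ} σ (x x' y y' : Tm Γ (σ ⁺)) (z z' : Tm Γ (σ ⁻))
  → HA⊢ Γ Δ (x ≐ x' ⊃ y ≐ y' ⊃ z ≐ z' ⊃ app σ x y z ⊃ app σ x' y' z')

dom-transport : ∀ {Γ Δ} σ {a b : Tm Γ (σ ⁺)}
  → HA⊢ Γ Δ (a ≐ b) → HA⊢ Γ Δ (dom σ a) → HA⊢ Γ Δ (dom σ b)
dom-transport σ p d = ⊃E (⊃E (dom-≐ σ _ _) p) d

app-transport : ∀ {Γ Δ} σ {x x' y y' : Tm Γ (σ ⁺)} {z z' : Tm Γ (σ ⁻)}
  → HA⊢ Γ Δ (x ≐ x') → HA⊢ Γ Δ (y ≐ y') → HA⊢ Γ Δ (z ≐ z')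
  → HA⊢ Γ Δ (app σ x y z) → HA⊢ Γ Δ (app σ x' y' z')
app-transport σ p q r d = ⊃E (⊃E (⊃E (⊃E (app-≐ σ _ _ _ _ _ _) p) q) r) d

dom-≐ 𝟘       a b = ⊃I (⊃I H0)
dom-≐ (σ ⊗ τ) a b =
  ⊃I (⊃I (∧I (dom-transport σ (·-congˡ H1) (∧E₁ H0)) (dom-transport τ (·-congˡ H1) (∧E₂ H0))))
dom-≐ (σ ⇒ τ) a b = ⊃I (⊃I (∧I total reflects))
  where
  total = ∀I (⊃I (dom-transport τ (·-congʳ (·-congˡ H2))
            (dom⇒-dom σ τ (cast (renF-dom vs (σ ⇒ τ) a) H1) H0)))
  reflects = ∀I (∀I (∀I (⊃I (⊃I (⊃I
    (app-transport σ (eq-refl v2) (eq-refl v1) (·-congʳ (·-congʳ (·-congʳ (·-congˡ H4))))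
      (dom⇒-app σ τ (cast (wkF³-dom (σ ⇒ τ) a) H3) H2 H1
        (app-transport τ (·-congʳ (·-congˡ (≐-sym H4))) (·-congʳ (·-congˡ (≐-sym H4)))
                         (eq-refl v0) H0))))))))

app-≐ 𝟘 x x' y y' z z' =
  ⊃I (⊃I (⊃I (⊃I (⊃I (⊃E H1 (≐-trans H4 (≐-trans H0 (≐-sym H3))))))))
app-≐ (σ ⊗ τ) x x' y y' z z' = ⊃I (⊃I (⊃I (⊃I (∧I left right))))
  where
  left = ⊃I (app-transport σ (·-congˡ H4) (·-congˡ H3) (·-congˡ (·-congˡ H2))
           (⊃E (∧E₁ H1) (≐-trans (·-congˡ H2) H0)))
  right = ⊃I (app-transport τ (·-congˡ H4) (·-congˡ H3) (·-congˡ (·-congˡ H2))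
            (⊃E (∧E₂ H1) (⊃I (⊃E H1 (≐-trans (≐-sym (·-congˡ H3)) H0)))))
app-≐ (σ ⇒ τ) x x' y y' z z' = ⊃I (⊃I (⊃I (⊃I
  (∧I (dom-transport σ (·-congˡ H1) (∧E₁ H0))
      (app-transport τ (·-cong (·-congˡ H3) (·-congˡ H1)) (·-cong (·-congˡ H2) (·-congˡ H1))
                       (·-congˡ H1) (∧E₂ H0))))))

-- app (σ ⇒ 𝟘) a b z unfolds to Separates σ a b (fst · z).
Separates : ∀ {Γ} σ → Tm Γ ((σ ⇒ 𝟘) ⁺) → Tm Γ ((σ ⇒ 𝟘) ⁺) → Tm Γ (σ ⁺) → Fm Γ
Separates σ a b u = dom σ u ∧ ¬' (fst · a · u ≐ fst · b · u)

separates-transport : ∀ {Γ Δ} σ {a b : Tm Γ ((σ ⇒ 𝟘) ⁺)} {u u' : Tm Γ (σ ⁺)}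
  → HA⊢ Γ Δ (u ≐ u') → HA⊢ Γ Δ (Separates σ a b u) → HA⊢ Γ Δ (Separates σ a b u')
separates-transport {Γ} σ {a} {b} {u} {u'} e s = ⊃E (⊃E separates-≐ e) s
  where
  separates-≐ : ∀ {Δ'} → HA⊢ Γ Δ' (u ≐ u' ⊃ Separates σ a b u ⊃ Separates σ a b u')
  separates-≐ = ⊃I (⊃I (∧I (dom-transport σ H1 (∧E₁ H0))
    (⊃I (⊃E (∧E₂ H1) (≐-trans (·-congˡ H2) (≐-trans H0 (·-congˡ (≐-sym H2))))))))

reflected : ∀ {Γ} σ τ → Tm Γ (φTy σ τ ⁺) → Tm Γ ((σ ⇒ 𝟘) ⁺) → Tm Γ ((σ ⇒ 𝟘) ⁺) → Tm Γ (τ ⁺)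
  → Tm Γ (σ ⁺)
reflected σ τ f x y v = fst · (snd · f · x · y · (pair · v · zero))

reflected-separates : ∀ {Γ Δ} σ τ {f : Tm Γ (φTy σ τ ⁺)} {x y : Tm Γ ((σ ⇒ 𝟘) ⁺)} {v : Tm Γ (τ ⁺)}
  → HA⊢ Γ Δ (dom (φTy σ τ) f) → HA⊢ Γ Δ (dom (σ ⇒ 𝟘) x) → HA⊢ Γ Δ (dom (σ ⇒ 𝟘) y)
  → HA⊢ Γ Δ (Separates τ (fst · f · x) (fst · f · y) v)
  → HA⊢ Γ Δ (Separates σ x y (reflected σ τ f x y v))
reflected-separates σ τ {v = v} df dx dy s =
  dom⇒-app (σ ⇒ 𝟘) (τ ⇒ 𝟘) df dx dy (separates-transport τ (≐-sym (ax-fst v zero)) s)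

inhabitant : ∀ {Γ} ρ → Tm Γ ρ
inhabitant 𝟘       = zero
inhabitant (a ⊗ b) = pair · inhabitant a · inhabitant b
inhabitant (a ⇒ b) = K · inhabitant b

lam : ∀ {Γ ρ τ} → Tm (ρ ∷ Γ) τ → Tm Γ (ρ ⇒ τ)
lam {ρ = ρ} (var vz) = S {σ = ρ ⇒ ρ} · K · K
lam (var (vs x))     = K · var x
lam K                = K · K
lam S                = K · S
lam pair             = K · pair
lam fst              = K · fst
lam snd              = K · snd
lam zero             = K · zero
lam suc              = K · suc
lam R                = K · R
lam (t · u)          = S · lam t · lam u

ext : ∀ {Γ Δ ρ} → Sub Γ Δ → Tm Δ ρ → Sub (ρ ∷ Γ) Δ
ext s u vz     = u
ext s u (vs x) = s x

lam-β : ∀ {Γ Δ Θ ρ τ} (s : Sub Γ Δ) (b : Tm (ρ ∷ Γ) τ) (u : Tm Δ ρ)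
  → HA⊢ Δ Θ (subT s (lam b) · u ≐ subT (ext s u) b)
lam-β s (var vz)     u = ≐-trans (ax-S K K u) (ax-K u (K · u))
lam-β s (var (vs x)) u = ax-K (s x) u
lam-β s K            u = ax-K _ u
lam-β s S            u = ax-K _ u
lam-β s pair         u = ax-K _ u
lam-β s fst          u = ax-K _ u
lam-β s snd          u = ax-K _ u
lam-β s zero         u = ax-K _ u
lam-β s suc          u = ax-K _ u
lam-β s R            u = ax-K _ u
lam-β s (t · t')     u = ≐-trans (ax-S _ _ u) (·-cong (lam-β s t u) (lam-β s t' u))

-- The statement does not ask for dom ρ Z, so the backward components of the
-- witness may be arbitrary.
lam⁺ : ∀ {Γ ρ τ χ} → Tm (ρ ∷ Γ) τ → Tm Γ ((ρ ⇒ τ) ⊗ χ)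
lam⁺ b = pair · lam b · inhabitant _

lam⁺-β : ∀ {Γ Δ Θ ρ τ χ} (s : Sub Γ Δ) (b : Tm (ρ ∷ Γ) τ) {P : Tm Δ ((ρ ⇒ τ) ⊗ χ)} (u : Tm Δ ρ)
  → HA⊢ Δ Θ (P ≐ subT s (lam⁺ b)) → HA⊢ Δ Θ (fst · P · u ≐ subT (ext s u) b)
lam⁺-β s b u p = ≐-trans (·-congʳ (≐-trans (·-congˡ p) (ax-fst _ _))) (lam-β s b u)

witness-body : (σ τ : Ty) → Tm (τ ⁺ ∷ (σ ⇒ 𝟘) ⁺ ∷ (σ ⇒ 𝟘) ⁺ ∷ φTy σ τ ⁺ ∷ []) (σ ⁺)
witness-body σ τ = reflected σ τ v3 v2 v1 v0

witness : (σ τ : Ty) → Tm [] (ρTy σ τ ⁺)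
witness σ τ = lam⁺ (lam⁺ (lam⁺ (lam⁺ (witness-body σ τ))))

witness-β : ∀ {Γ Θ} σ τ {Z : Tm Γ (ρTy σ τ ⁺)} → Z ≡ embed (witness σ τ)
  → (f : Tm Γ (φTy σ τ ⁺)) (x y : Tm Γ ((σ ⇒ 𝟘) ⁺)) (v : Tm Γ (τ ⁺))
  → HA⊢ Γ Θ (fst · (fst · (fst · (fst · Z · f) · x) · y) · v ≐ reflected σ τ f x y v)
witness-β σ τ refl f x y v =
  lam⁺-β s₃ b v (lam⁺-β s₂ (lam⁺ b) y (lam⁺-β s₁ (lam⁺ (lam⁺ b)) x
    (lam⁺-β none (lam⁺ (lam⁺ (lam⁺ b))) f (eq-refl _))))
  where
  b = witness-body σ τ
  s₁ = ext none f
  s₂ = ext s₁ x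
  s₃ = ext s₂ y

Spec : (σ τ : Ty) → Fm (ρTy σ τ ⁺ ∷ [])
Spec σ τ = ∀' (φTy σ τ ⁺) (∀' ((σ ⇒ 𝟘) ⁺) (∀' ((σ ⇒ 𝟘) ⁺) (∀' (τ ⁺)
  (fst · (fst · (fst · (fst · var (vs (vs (vs (vs vz)))) · v3) · v2) · v1) · v0
     ≐ reflected σ τ v3 v2 v1 v0))))

witness-satisfies-Spec : ∀ σ τ → HAω⊢ (Spec σ τ [ witness σ τ ])
witness-satisfies-Spec σ τ =
  ∀I (∀I (∀I (∀I (witness-β σ τ (wkT⁴-closed (witness σ τ)) v3 v2 v1 v0))))

-- Proving Φ for a generic Z satisfying Spec and only then instantiating avoids
-- computing Φ [ t ], which is stuck on dom at abstract types.
∃I-by-spec : ∀ {Γ Δ ρ} (ψ : Fm (ρ ∷ Γ)) {Φ : Fm (ρ ∷ Γ)} (t : Tm Γ ρ)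
  → HA⊢ Γ Δ (ψ [ t ]) → HA⊢ (ρ ∷ Γ) (ψ ∷ map wkF Δ) Φ → HA⊢ Γ Δ (∃' ρ Φ)
∃I-by-spec ψ t s d = ∃I t (⊃E (∀E (∀I (⊃I d)) t) s)

theorem5p6 : (σ τ : Ty) → HAω⊢ (Thm5p6Formula σ τ)
theorem5p6 σ τ =
  ∃I-by-spec (Spec σ τ) (witness σ τ) (witness-satisfies-Spec σ τ)
    (∀I (⊃I (∀I (⊃I (∀I (⊃I (∀I (⊃I (⊃I
      (separates-transport σ (≐-sym (∀E (∀E (∀E (∀E H5 v3) v2) v1) v0))
        (reflected-separates σ τ
          (cast (wkF³-dom (φTy σ τ) v0) H4)
          (cast (wkF²-dom (σ ⇒ 𝟘) v0) H3)
          (cast (renF-dom vs (σ ⇒ 𝟘) v0) H2)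
          (∧I H1 H0))))))))))))
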